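{- For each $n\ge 2$ let $t_n$ be the relation $$(LR)^n LL = RR\,L^{2n-2}\,RL$$ over the alphabet $\{L,R\}$ (here $(LR)^n$ is $n$ copies of $LR$ and $L^{2n-2}$ is $2n-2$ copies of $L$), and let $S=\{t_2,t_3,\ldots\}$. For every subset $T\subseteq S$, the poset $P(M_T)$ associated with the monoid $M_T$ presented by the alphabet $\{L,R\}$ and the relations in $T$ is upho.
   Context: The monoid $M_T$ consists of finite words over $\{L,R\}$ modulo the congruence generated by the relations in $T$, with concatenation. The associated poset $P(M_T)$ has underlying set $M_T$, with $X$ covering $Y$ iff $X=Ya$ for some letter $a\in\{L,R\}$; the order is $Y\le X$ iff $X=YZ$ for some $Z\in M_T$, and the rank of an element is its word length. A ranked poset $P$ (disjoint decomposition $P=P_0\sqcup P_1\sqcup\cdots$ with covers increasing rank by exactly one) is upho if every $P_i$ is finite and $V_{P,s}=\{t\in P:t\ge s\}\cong P$ for all $s\in P$. -}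

module Defs where

open import Data.Nat using (ℕ; zero; suc; _*_; _∸_; _≤_)
open import Data.List using (List; []; _∷_; _++_; replicate; concat; length)
open import Data.List.Membership.Propositional using (_∈_)
open import Data.Product using (Σ; ∃; _×_; _,_; proj₁)
open import Relation.Nullary using (¬_)
open import Relation.Binary using (Rel; IsPartialOrder)
open import Relation.Binary.PropositionalEquality using (_≡_)
open import Level using (Level; _⊔_)

data Letter : Set where
  L R : Letter

Word : Set
Word = List Letter

lhs : ℕ → Word
lhs n = concat (replicate n (L ∷ R ∷ [])) ++ (L ∷ L ∷ [])

rhs : ℕ → Word
rhs n = (R ∷ R ∷ []) ++ replicate (2 * n ∸ 2) L ++ (R ∷ L ∷ [])

-- The congruence on words generated by the relations t_n, n ∈ T.
-- (T ⊆ ℕ is a subset; the theorem assumes T ⊆ {2,3,...}.)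

data _∼[_]_ : Word → (ℕ → Set) → Word → Set₁ where
  gen   : ∀ {T} n → T n → lhs n ∼[ T ] rhs n
  ∼refl : ∀ {T} u → u ∼[ T ] u
  ∼sym  : ∀ {T u v} → u ∼[ T ] v → v ∼[ T ] u
  ∼trans : ∀ {T u v w} → u ∼[ T ] v → v ∼[ T ] w → u ∼[ T ] w
  ∼ctx  : ∀ {T u v} x y → u ∼[ T ] v → (x ++ u ++ y) ∼[ T ] (x ++ v ++ y)

_≈M[_]_ : Word → (ℕ → Set) → Word → Set₁
u ≈M[ T ] v = u ∼[ T ] v

_≤M[_]_ : Word → (ℕ → Set) → Word → Set₁
Y ≤M[ T ] X = Σ Word λ Z → X ∼[ T ] (Y ++ Z)

module _ {a ℓ : Level} {A : Set a} (_≈_ : Rel A ℓ) (_≤_ : Rel A ℓ) (rank : A → ℕ) where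

  _<_ : Rel A ℓ
  x < y = (x ≤ y) × ¬ (x ≈ y)

  _⋖_ : Rel A (a ⊔ ℓ)
  x ⋖ y = (x < y) × ¬ (Σ A λ z → (x < z) × (z < y))

  IsRanked : Set (a ⊔ ℓ)
  IsRanked = (∀ {x y} → x ≈ y → rank x ≡ rank y)
           × (∀ {x y} → x ⋖ y → rank y ≡ suc (rank x))

  LevelFinite : ℕ → Set (a ⊔ ℓ)
  LevelFinite i = Σ (List A) λ xs → ∀ x → rank x ≡ i → Σ A λ y → (y ∈ xs) × (x ≈ y)

  V : A → Set (a ⊔ ℓ)
  V s = Σ A λ t → s ≤ t

  record UpperIso (s : A) : Set (a ⊔ ℓ) where
    field
      to      : V s → A
      from    : A → V s
      to-cong   : ∀ {x y} → proj₁ x ≈ proj₁ y → to x ≈ to y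
      from-cong : ∀ {x y} → x ≈ y → proj₁ (from x) ≈ proj₁ (from y)
      to∘from : ∀ x → to (from x) ≈ x
      from∘to : ∀ x → proj₁ (from (to x)) ≈ proj₁ x
      to-mono   : ∀ {x y} → proj₁ x ≤ proj₁ y → to x ≤ to y
      to-reflect : ∀ {x y} → to x ≤ to y → proj₁ x ≤ proj₁ y

  IsUpho : Set (a ⊔ ℓ)
  IsUpho = IsPartialOrder _≈_ _≤_
         × IsRanked
         × (∀ i → LevelFinite i)
         × (∀ s → UpperIso s)

P-upho : (ℕ → Set) → Set₁
P-upho T = IsUpho (λ u v → u ≈M[ T ] v) (λ u v → u ≤M[ T ] v) length

-- The relations preserve word length, so P(M_T) is graded by length: the levels are finite and a
-- cover appends one letter.  The upper set of s is then isomorphic to P(M_T) via  sZ ↦ Z  as soon as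
-- M_T is left-cancellative.  Left cancellation is proved by induction on length together with a
-- description of u ∼ v by first letters: either u and v start with the same letter and their tails
-- are equivalent, or a relation t_n was applied at the front.  The second alternative is pinned down
-- because a word beginning with L is never equivalent to one beginning with RL (infinite descent, using
-- n ≥ 2), so (LR)^a LL y and L^a RL y determine a and y up to equivalence.
module Submission where

open import Defs hiding (_<_)
open import Data.Nat using (ℕ; zero; suc; _+_; _*_; _∸_; _≤_; _<_; s≤s)
open import Data.Nat.Properties
  using (*-suc; +-comm; *-cancelˡ-≡; suc-injective; 0≢1+n; m+1+n≢m; <⇒≤; ≤-refl; ≤-trans)
open import Data.List using (List; []; _∷_; _++_; replicate; concat; length; map)
open import Data.List.Properties
  using (++-assoc; ++-identityʳ; length-++; length-replicate; length-++-≤ˡ; length-++-≤ʳ; ∷-injectiveʳ)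
open import Data.List.Membership.Propositional using (_∈_)
open import Data.List.Membership.Propositional.Properties using (∈-++⁺ˡ; ∈-++⁺ʳ; ∈-map⁺)
open import Data.List.Relation.Unary.Any using (here)
open import Data.Product using (_×_; _,_; proj₁; map₁)
open import Data.Empty using (⊥-elim)
open import Function using (_∘_)
open import Relation.Nullary using (¬_)
open import Relation.Binary using (Setoid; IsEquivalence; IsPartialOrder)
open import Relation.Binary.PropositionalEquality using (_≡_; refl; sym; trans; cong; subst; module ≡-Reasoning)
import Relation.Binary.Reasoning.Setoid as SetoidReasoning

LR : Word
LR = L ∷ R ∷ []

power : ℕ → Word → Word
power a p = concat (replicate a p)

power-[x] : ∀ a x → power a (x ∷ []) ≡ replicate a x
power-[x] zero    x = refl
power-[x] (suc a) x = cong (x ∷_) (power-[x] a x)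

wordsOfLength : ℕ → List Word
wordsOfLength zero    = [] ∷ []
wordsOfLength (suc i) = map (L ∷_) (wordsOfLength i) ++ map (R ∷_) (wordsOfLength i)

∈-wordsOfLength : ∀ w → w ∈ wordsOfLength (length w)
∈-wordsOfLength []      = here refl
∈-wordsOfLength (L ∷ w) = ∈-++⁺ˡ (∈-map⁺ (L ∷_) (∈-wordsOfLength w))
∈-wordsOfLength (R ∷ w) = ∈-++⁺ʳ _ (∈-map⁺ (R ∷_) (∈-wordsOfLength w))

module _ {T : ℕ → Set} where

  ∼-isEquivalence : IsEquivalence (λ u v → u ∼[ T ] v)
  ∼-isEquivalence = record { refl = ∼refl _ ; sym = ∼sym ; trans = ∼trans }

  ≡⇒∼ : ∀ {u v} → u ≡ v → u ∼[ T ] v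
  ≡⇒∼ refl = ∼refl _

  ∼-congʳ : ∀ z {u v} → u ∼[ T ] v → (u ++ z) ∼[ T ] (v ++ z)
  ∼-congʳ z = ∼ctx [] z

  ∼-congˡ : ∀ x {u v} → u ∼[ T ] v → (x ++ u) ∼[ T ] (x ++ v)
  ∼-congˡ x {u} {v} e =
    ∼trans (≡⇒∼ (cong (x ++_) (sym (++-identityʳ u))))
      (∼trans (∼ctx x [] e) (≡⇒∼ (cong (x ++_) (++-identityʳ v))))

∼-setoid : (ℕ → Set) → Setoid _ _
∼-setoid T = record { Carrier = Word ; _≈_ = λ u v → u ∼[ T ] v ; isEquivalence = ∼-isEquivalence }

2*[1+n]∸2≡2*n : ∀ n → 2 * suc n ∸ 2 ≡ 2 * n
2*[1+n]∸2≡2*n n = cong (_∸ 2) (*-suc 2 n)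

length-lhs : ∀ n → length (lhs n) ≡ 2 + 2 * n
length-lhs zero    = refl
length-lhs (suc n) = cong (2 +_) (trans (length-lhs n) (sym (*-suc 2 n)))

length-rhs : ∀ n → length (rhs n) ≡ 2 + ((2 * n ∸ 2) + 2)
length-rhs n = cong (2 +_)
  (trans (length-++ (replicate (2 * n ∸ 2) L)) (cong (_+ 2) (length-replicate (2 * n ∸ 2))))

length-lhs≡length-rhs : ∀ n → length (lhs (suc n)) ≡ length (rhs (suc n))
length-lhs≡length-rhs n = begin
  length (lhs (suc n))        ≡⟨ length-lhs (suc n) ⟩
  2 + 2 * suc n               ≡⟨ cong (2 +_) (*-suc 2 n) ⟩
  2 + (2 + 2 * n)             ≡⟨ cong (2 +_) (+-comm 2 (2 * n)) ⟩
  2 + (2 * n + 2)             ≡⟨ cong (λ a → 2 + (a + 2)) (2*[1+n]∸2≡2*n n) ⟨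
  2 + ((2 * suc n ∸ 2) + 2)   ≡⟨ length-rhs (suc n) ⟨
  length (rhs (suc n))        ∎
  where open ≡-Reasoning

length-++-cong : ∀ x y {u v : Word} → length u ≡ length v → length (x ++ u ++ y) ≡ length (x ++ v ++ y)
length-++-cong []      y {u} {v} eq = trans (length-++ u) (trans (cong (_+ length y) eq) (sym (length-++ v)))
length-++-cong (_ ∷ x) y         eq = cong suc (length-++-cong x y eq)

∼-length : ∀ {T} → (∀ n → T n → 1 ≤ n) → ∀ {u v} → u ∼[ T ] v → length u ≡ length v
∼-length T≥1 (gen zero t) with T≥1 zero t
... | ()
∼-length T≥1 (gen (suc n) t)  = length-lhs≡length-rhs n
∼-length T≥1 (∼refl u)        = refl
∼-length T≥1 (∼sym e)         = sym (∼-length T≥1 e)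
∼-length T≥1 (∼trans e e′)    = trans (∼-length T≥1 e) (∼-length T≥1 e′)
∼-length T≥1 (∼ctx x y e)     = length-++-cong x y (∼-length T≥1 e)

-- For n = 2 + k:  lhs n ++ y ≡ L ∷ lhs-tail k y  and  rhs n ++ y ≡ R ∷ rhs-tail k y.
lhs-tail : ℕ → Word → Word
lhs-tail k y = R ∷ power (suc k) LR ++ L ∷ L ∷ y

rhs-tail : ℕ → Word → Word
rhs-tail k y = R ∷ power (2 * suc k) (L ∷ []) ++ R ∷ L ∷ y

rhs≡R∷rhs-tail : ∀ k → rhs (2 + k) ≡ R ∷ rhs-tail k []
rhs≡R∷rhs-tail k = cong (λ w → R ∷ R ∷ w ++ R ∷ L ∷ []) (begin
  replicate (2 * (2 + k) ∸ 2) L ≡⟨ cong (λ a → replicate a L) (2*[1+n]∸2≡2*n (suc k)) ⟩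
  replicate (2 * suc k) L       ≡⟨ power-[x] (2 * suc k) L ⟨
  power (2 * suc k) (L ∷ [])    ∎)
  where open ≡-Reasoning

lhs-tail-++ : ∀ k y z → lhs-tail k y ++ z ≡ lhs-tail k (y ++ z)
lhs-tail-++ k y z = cong (R ∷_) (++-assoc (power (suc k) LR) (L ∷ L ∷ y) z)

rhs-tail-++ : ∀ k y z → rhs-tail k y ++ z ≡ rhs-tail k (y ++ z)
rhs-tail-++ k y z = cong (R ∷_) (++-assoc (power (2 * suc k) (L ∷ [])) (R ∷ L ∷ y) z)

module UphoCriterion (T : ℕ → Set)
    (length-invariant : ∀ {u v} → u ∼[ T ] v → length u ≡ length v)
    (left-cancellative : ∀ s {u v} → (s ++ u) ∼[ T ] (s ++ v) → u ∼[ T ] v) where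

  open SetoidReasoning (∼-setoid T)

  infix 4 _≈_ _≼_
  _≈_ : Word → Word → Set₁
  u ≈ v = u ≈M[ T ] v

  _≼_ : Word → Word → Set₁
  u ≼ v = u ≤M[ T ] v

  ≁-extension : ∀ x a z → ¬ (x ≈ x ++ a ∷ z)
  ≁-extension x a z e = m+1+n≢m (length x) (sym (trans (length-invariant e) (length-++ x)))

  ≼-reflexive : ∀ {u v} → u ≈ v → u ≼ v
  ≼-reflexive {u} e = [] , ∼trans (∼sym e) (≡⇒∼ (sym (++-identityʳ u)))

  ≼-trans : ∀ {u v w} → u ≼ v → v ≼ w → u ≼ w
  ≼-trans {u} {v} {w} (Z , v∼uZ) (Z′ , w∼vZ′) = Z ++ Z′ , (begin
    w             ≈⟨ w∼vZ′ ⟩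
    v ++ Z′       ≈⟨ ∼-congʳ Z′ v∼uZ ⟩
    (u ++ Z) ++ Z′ ≡⟨ ++-assoc u Z Z′ ⟩
    u ++ Z ++ Z′  ∎)

  ≼-antisym : ∀ {u v} → u ≼ v → v ≼ u → u ≈ v
  ≼-antisym {u} ([] , v∼u) _ = ∼sym (∼trans v∼u (≡⇒∼ (++-identityʳ u)))
  ≼-antisym {u} {v} (a ∷ Z , v∼uaZ) (W , u∼vW) = ⊥-elim (≁-extension u a (Z ++ W) (begin
    u                ≈⟨ u∼vW ⟩
    v ++ W           ≈⟨ ∼-congʳ W v∼uaZ ⟩
    (u ++ a ∷ Z) ++ W ≡⟨ ++-assoc u (a ∷ Z) W ⟩
    u ++ a ∷ Z ++ W  ∎))

  ≼-isPartialOrder : IsPartialOrder _≈_ _≼_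
  ≼-isPartialOrder = record
    { isPreorder = record { isEquivalence = ∼-isEquivalence ; reflexive = ≼-reflexive ; trans = ≼-trans }
    ; antisym    = ≼-antisym
    }

  ⋖⇒length≡suc : ∀ {u v} → _⋖_ _≈_ _≼_ length u v → length v ≡ suc (length u)
  ⋖⇒length≡suc {u} ((([] , v∼u) , u≉v) , _) = ⊥-elim (u≉v (∼sym (∼trans v∼u (≡⇒∼ (++-identityʳ u)))))
  ⋖⇒length≡suc {u} (((a ∷ [] , v∼ua) , _) , _) =
    trans (length-invariant v∼ua) (trans (length-++ u) (+-comm (length u) 1))
  ⋖⇒length≡suc {u} {v} (((a ∷ b ∷ Z , v∼uabZ) , _) , nothing-between) =
    ⊥-elim (nothing-between (u ++ a ∷ [] , u<ua , ua<v))
    where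
      v∼ua·bZ : v ≈ (u ++ a ∷ []) ++ b ∷ Z
      v∼ua·bZ = ∼trans v∼uabZ (≡⇒∼ (sym (++-assoc u (a ∷ []) (b ∷ Z))))
      u<ua : (u ≼ u ++ a ∷ []) × ¬ (u ≈ u ++ a ∷ [])
      u<ua = (a ∷ [] , ∼refl _) , ≁-extension u a []
      ua<v : (u ++ a ∷ [] ≼ v) × ¬ (u ++ a ∷ [] ≈ v)
      ua<v = (b ∷ Z , v∼ua·bZ) , λ e → ≁-extension (u ++ a ∷ []) b Z (∼trans e v∼ua·bZ)

  levelFinite : ∀ i → LevelFinite _≈_ _≼_ length i
  levelFinite i = wordsOfLength i , λ w |w|≡i →
    w , subst (λ j → w ∈ wordsOfLength j) |w|≡i (∈-wordsOfLength w) , ∼refl w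

  upperIso : ∀ s → UpperIso _≈_ _≼_ length s
  upperIso s = record
    { to         = quotient
    ; from       = λ Z → s ++ Z , Z , ∼refl _
    ; to-cong    = λ {x} {y} → quotient-cong {x} {y}
    ; from-cong  = ∼-congˡ s
    ; to∘from    = ∼refl
    ; from∘to    = λ (_ , _ , t∼sZ) → ∼sym t∼sZ
    ; to-mono    = λ {x} {y} → quotient-mono {x} {y}
    ; to-reflect = λ {x} {y} → quotient-reflect {x} {y}
    }
    where
      Vₛ : Set₁
      Vₛ = V _≈_ _≼_ length s

      quotient : Vₛ → Word
      quotient (_ , Z , _) = Z

      quotient-cong : ∀ {x y : Vₛ} → proj₁ x ≈ proj₁ y → quotient x ≈ quotient y
      quotient-cong {t , Z , t∼sZ} {t′ , Z′ , t′∼sZ′} t∼t′ = left-cancellative s (begin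
        s ++ Z  ≈⟨ t∼sZ ⟨
        t       ≈⟨ t∼t′ ⟩
        t′      ≈⟨ t′∼sZ′ ⟩
        s ++ Z′ ∎)

      quotient-mono : ∀ {x y : Vₛ} → proj₁ x ≼ proj₁ y → quotient x ≼ quotient y
      quotient-mono {t , Z , t∼sZ} {t′ , Z′ , t′∼sZ′} (W , t′∼tW) = W , left-cancellative s (begin
        s ++ Z′       ≈⟨ t′∼sZ′ ⟨
        t′            ≈⟨ t′∼tW ⟩
        t ++ W        ≈⟨ ∼-congʳ W t∼sZ ⟩
        (s ++ Z) ++ W ≡⟨ ++-assoc s Z W ⟩
        s ++ Z ++ W   ∎)

      quotient-reflect : ∀ {x y : Vₛ} → quotient x ≼ quotient y → proj₁ x ≼ proj₁ y
      quotient-reflect {t , Z , t∼sZ} {t′ , Z′ , t′∼sZ′} (W , Z′∼ZW) = W , (begin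
        t′            ≈⟨ t′∼sZ′ ⟩
        s ++ Z′       ≈⟨ ∼-congˡ s Z′∼ZW ⟩
        s ++ Z ++ W   ≡⟨ ++-assoc s Z W ⟨
        (s ++ Z) ++ W ≈⟨ ∼-congʳ W t∼sZ ⟨
        t ++ W        ∎)

  upho : P-upho T
  upho = ≼-isPartialOrder , (length-invariant , ⋖⇒length≡suc) , levelFinite , upperIso

module LeftCancellation (T : ℕ → Set) (T≥2 : ∀ n → T n → 2 ≤ n) where

  infix 4 _∼_
  _∼_ : Word → Word → Set₁
  u ∼ v = u ∼[ T ] v

  length-invariant : ∀ {u v} → u ∼ v → length u ≡ length v
  length-invariant = ∼-length (λ n t → <⇒≤ (T≥2 n t))

  lhs-tail-congʳ : ∀ k {y y′} → y ∼ y′ → lhs-tail k y ∼ lhs-tail k y′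
  lhs-tail-congʳ k = ∼-congˡ (R ∷ power (suc k) LR) ∘ ∼-congˡ (L ∷ L ∷ [])

  rhs-tail-congʳ : ∀ k {y y′} → y ∼ y′ → rhs-tail k y ∼ rhs-tail k y′
  rhs-tail-congʳ k = ∼-congˡ (R ∷ power (2 * suc k) (L ∷ [])) ∘ ∼-congˡ (R ∷ L ∷ [])

  -- The first letter of a word can only change by applying a relation at the very front.
  data HeadSplit : Word → Word → Set₁ where
    empty   : HeadSplit [] []
    same    : ∀ c {u v} → u ∼ v → HeadSplit (c ∷ u) (c ∷ v)
    lhs→rhs : ∀ k → T (2 + k) → ∀ y {u v} → u ∼ lhs-tail k y → v ∼ rhs-tail k y → HeadSplit (L ∷ u) (R ∷ v)
    rhs→lhs : ∀ k → T (2 + k) → ∀ y {u v} → u ∼ lhs-tail k y → v ∼ rhs-tail k y → HeadSplit (R ∷ v) (L ∷ u)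

  headSplit-refl : ∀ u → HeadSplit u u
  headSplit-refl []      = empty
  headSplit-refl (c ∷ u) = same c (∼refl u)

  headSplit-sym : ∀ {u v} → HeadSplit u v → HeadSplit v u
  headSplit-sym empty                 = empty
  headSplit-sym (same c e)            = same c (∼sym e)
  headSplit-sym (lhs→rhs k t y e e′)  = rhs→lhs k t y e e′
  headSplit-sym (rhs→lhs k t y e e′)  = lhs→rhs k t y e e′

  headSplit-++ʳ : ∀ {u v} → HeadSplit u v → ∀ z → HeadSplit (u ++ z) (v ++ z)
  headSplit-++ʳ empty                z = headSplit-refl z
  headSplit-++ʳ (same c e)           z = same c (∼-congʳ z e)
  headSplit-++ʳ (lhs→rhs k t y e e′) z =
    lhs→rhs k t (y ++ z) (∼trans (∼-congʳ z e) (≡⇒∼ (lhs-tail-++ k y z)))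
                         (∼trans (∼-congʳ z e′) (≡⇒∼ (rhs-tail-++ k y z)))
  headSplit-++ʳ (rhs→lhs k t y e e′) z =
    rhs→lhs k t (y ++ z) (∼trans (∼-congʳ z e) (≡⇒∼ (lhs-tail-++ k y z)))
                         (∼trans (∼-congʳ z e′) (≡⇒∼ (rhs-tail-++ k y z)))

  headSplit-gen : ∀ {n} → T n → 2 ≤ n → HeadSplit (lhs n) (rhs n)
  headSplit-gen {suc (suc k)} t (s≤s (s≤s _)) =
    lhs→rhs k t [] (∼refl _) (≡⇒∼ (∷-injectiveʳ (rhs≡R∷rhs-tail k)))

  HeadSplitBelow : ℕ → Set₁
  HeadSplitBelow N = ∀ {u v} → length u < N → u ∼ v → HeadSplit u v

  module Below {N} (split : HeadSplitBelow N) where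

    Short : Word → Set
    Short w = length w < N

    short-∼ : ∀ {u v} → u ∼ v → Short u → Short v
    short-∼ e = subst (_< N) (length-invariant e)

    short-suffix : ∀ x {w} → Short (x ++ w) → Short w
    short-suffix x {w} = ≤-trans (s≤s (length-++-≤ʳ w {x}))

    cancel-head : ∀ {c u v} → Short (c ∷ u) → c ∷ u ∼ c ∷ v → u ∼ v
    cancel-head lt e with split lt e
    ... | same _ u∼v = u∼v

    cancel-prefix : ∀ s {u v} → Short (s ++ u) → s ++ u ∼ s ++ v → u ∼ v
    cancel-prefix []      lt e = e
    cancel-prefix (_ ∷ s) lt e = cancel-prefix s (<⇒≤ lt) (cancel-head lt e)

    -- Infinite descent: a witness of  L x ∼ R L β  yields one of  L β ∼ R L β′  with β shorter than x.
    L∷≁R∷L∷ : ∀ {x β} → Short (L ∷ x) → ¬ (L ∷ x ∼ R ∷ L ∷ β)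
    L∷≁R∷L∷ {x} = descend (length x) refl
      where
        descend : ∀ m {x β} → length x ≡ m → Short (L ∷ x) → ¬ (L ∷ x ∼ R ∷ L ∷ β)
        descend zero    |x|≡0 _ e = 0≢1+n (trans (sym |x|≡0) (suc-injective (length-invariant e)))
        descend (suc m) {β = β} |x|≡1+m lt e with split lt e
        ... | lhs→rhs _ _ _ _ Lβ∼rhs-tail =
          descend m {β} (suc-injective (trans (sym (suc-injective (length-invariant e))) |x|≡1+m))
                    (<⇒≤ (short-∼ e lt)) Lβ∼rhs-tail

    R∷L∷≁L∷ : ∀ {x z} → Short (R ∷ L ∷ x) → ¬ (R ∷ L ∷ x ∼ L ∷ z)
    R∷L∷≁L∷ lt e = L∷≁R∷L∷ (short-∼ e lt) (∼sym e)

    -- Separation is only required for words p^(b+1) m z, since p and m may share a prefix (LR and LL do).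
    power-cancel : ∀ p m {y y′} →
      (∀ b {z z′} → Short (power (suc b) p ++ m ++ z) → ¬ (power (suc b) p ++ m ++ z ∼ m ++ z′)) →
      ∀ a b → Short (power a p ++ m ++ y) → power a p ++ m ++ y ∼ power b p ++ m ++ y′ → a ≡ b × y ∼ y′
    power-cancel p m separated zero    zero    lt e = refl , cancel-prefix m lt e
    power-cancel p m separated zero    (suc b) lt e = ⊥-elim (separated b (short-∼ e lt) (∼sym e))
    power-cancel p m separated (suc a) zero    lt e = ⊥-elim (separated a lt e)
    power-cancel p m {y} {y′} separated (suc a) (suc b) lt e =
      map₁ (cong suc) (power-cancel p m separated a b (short-suffix p lt′) (cancel-prefix p lt′ e′))
      where
        lt′ : Short (p ++ power a p ++ m ++ y)
        lt′ = subst Short (++-assoc p (power a p) (m ++ y)) lt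
        e′ : p ++ power a p ++ m ++ y ∼ p ++ power b p ++ m ++ y′
        e′ = ∼trans (≡⇒∼ (sym (++-assoc p (power a p) (m ++ y))))
               (∼trans e (≡⇒∼ (++-assoc p (power b p) (m ++ y′))))

    LR-separated : ∀ b {z z′} → Short (power (suc b) LR ++ L ∷ L ∷ z) →
                   ¬ (power (suc b) LR ++ L ∷ L ∷ z ∼ L ∷ L ∷ z′)
    LR-separated zero    lt e = R∷L∷≁L∷ (<⇒≤ lt) (cancel-head lt e)
    LR-separated (suc b) lt e = R∷L∷≁L∷ (<⇒≤ lt) (cancel-head lt e)

    lhs-tail-cancel : ∀ {k j y y′} → Short (lhs-tail k y) → lhs-tail k y ∼ lhs-tail j y′ → k ≡ j × y ∼ y′
    lhs-tail-cancel {k} {j} lt e =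
      map₁ suc-injective (power-cancel LR (L ∷ L ∷ []) LR-separated (suc k) (suc j) (<⇒≤ lt) (cancel-head lt e))

    rhs-tail-cancel : ∀ {k j y y′} → Short (rhs-tail k y) → rhs-tail k y ∼ rhs-tail j y′ → k ≡ j × y ∼ y′
    rhs-tail-cancel {k} {j} lt e =
      map₁ (suc-injective ∘ *-cancelˡ-≡ (suc k) (suc j) 2)
        (power-cancel (L ∷ []) (R ∷ L ∷ []) (λ _ → L∷≁R∷L∷) (2 * suc k) (2 * suc j) (<⇒≤ lt) (cancel-head lt e))

    headSplit-trans : ∀ {u v w} → length v ≤ N → HeadSplit u v → HeadSplit v w → HeadSplit u w
    headSplit-trans _ empty                  empty                  = empty
    headSplit-trans _ (same c e)             (same .c e′)           = same c (∼trans e e′)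
    headSplit-trans _ (same .L e)            (lhs→rhs k t y e₁ e₂)  = lhs→rhs k t y (∼trans e e₁) e₂
    headSplit-trans _ (same .R e)            (rhs→lhs k t y e₁ e₂)  = rhs→lhs k t y e₁ (∼trans e e₂)
    headSplit-trans _ (lhs→rhs k t y e₁ e₂)  (same .R e)            = lhs→rhs k t y e₁ (∼trans (∼sym e) e₂)
    headSplit-trans _ (rhs→lhs k t y e₁ e₂)  (same .L e)            = rhs→lhs k t y (∼trans (∼sym e) e₁) e₂
    headSplit-trans lt (lhs→rhs k _ y u∼lhs v∼rhs) (rhs→lhs j _ y′ w∼lhs v∼rhs′)
      with rhs-tail-cancel {k} {j} (short-∼ v∼rhs lt) (∼trans (∼sym v∼rhs) v∼rhs′)
    ... | refl , y∼y′ = same L (∼trans u∼lhs (∼trans (lhs-tail-congʳ k y∼y′) (∼sym w∼lhs)))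
    headSplit-trans lt (rhs→lhs k _ y v∼lhs u∼rhs) (lhs→rhs j _ y′ v∼lhs′ w∼rhs)
      with lhs-tail-cancel {k} {j} (short-∼ v∼lhs lt) (∼trans (∼sym v∼lhs) v∼lhs′)
    ... | refl , y∼y′ = same R (∼trans u∼rhs (∼trans (rhs-tail-congʳ k y∼y′) (∼sym w∼rhs)))

  headSplit-step : ∀ {N} → HeadSplitBelow N → ∀ {u v} → length u ≤ N → u ∼ v → HeadSplit u v
  headSplit-step split lt (gen n t)        = headSplit-gen t (T≥2 n t)
  headSplit-step split lt (∼refl u)        = headSplit-refl u
  headSplit-step {N} split lt (∼sym e)     =
    headSplit-sym (headSplit-step split (subst (_≤ N) (sym (length-invariant e)) lt) e)
  headSplit-step {N} split lt (∼trans e e′) =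
    Below.headSplit-trans split lt′ (headSplit-step split lt e) (headSplit-step split lt′ e′)
    where lt′ = subst (_≤ N) (length-invariant e) lt
  headSplit-step split lt (∼ctx {u = u} [] z e) =
    headSplit-++ʳ (headSplit-step split (≤-trans (length-++-≤ˡ u) lt) e) z
  headSplit-step split lt (∼ctx (c ∷ x) z e)     = same c (∼ctx x z e)

  headSplitBelow : ∀ N → HeadSplitBelow N
  headSplitBelow (suc N) (s≤s lt) = headSplit-step (headSplitBelow N) lt

  ∼-cancelˡ : ∀ s {u v} → s ++ u ∼ s ++ v → u ∼ v
  ∼-cancelˡ s {u} = Below.cancel-prefix (headSplitBelow (suc (length (s ++ u)))) s ≤-refl

lemma5p6 : (T : ℕ → Set) → (∀ n → T n → 2 ≤ n) → P-upho T
lemma5p6 T T≥2 = UphoCriterion.upho T length-invariant ∼-cancelˡ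
  where open LeftCancellation T T≥2
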